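{- Let $k\ge 1$ and let $L_i(x)=a_ix+b_i$ and $H_j(x)=c_jx+d_j$ ($1\le i,j\le k$) be linear polynomials with integer coefficients such that $a_i>0$ and $c_j>0$ for all $i,j$, and $$a_id_j\neq b_ic_j\quad\text{for all }1\le i,j\le k.$$ Suppose that for every prime $p$ there is at least one integer $n_p$ such that $p$ divides none of $L_1(n_p),\dots,L_k(n_p)$. Then there exist constants $c>0$ and $x_0$, depending on the polynomials $L_i$ and $H_j$, such that for all $x\ge x_0$ the number of positive integers $n\le x$ satisfying $$\sigma(H_j(n))>\max_{1\le i\le k}\sigma(L_i(n))\quad\text{for all }1\le j\le k$$ is at least $c\,x(\log x)^{ -k}$.
   Context: $\sigma(n)=\sum_{d\mid n} d$ denotes the sum of the positive divisors of the positive integer $n$. -}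

module Defs where

open import Data.Nat using (ℕ; zero; suc; _+_; _*_; _<_; _⊔_; _<?_)
open import Data.Nat.Divisibility using (_∣?_)
open import Data.Integer as ℤ using (ℤ; +_; ∣_∣)
open import Data.Fin using (Fin)
open import Data.Fin.Properties using (all?)
open import Data.Nat.ListAction using (sum)
open import Data.List using (List; filter; map; upTo; length)
open import Data.Product using (_×_)
open import Data.Product.Properties using ()
open import Relation.Nullary using (Dec)
open import Relation.Nullary.Decidable using (_×-dec_)
import Data.Vec.Functional as VF

-- σ(n) = sum of the positive divisors of n (σ 0 = 0, irrelevant below).
σ : ℕ → ℕ
σ n = sum (filter (λ d → d ∣? n) (map suc (upTo n)))

lin : ℤ → ℤ → ℤ → ℤ
lin a b x = a ℤ.* x ℤ.+ b

maxFin : ∀ {k} → (Fin k → ℕ) → ℕ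
maxFin {k} f = VF.foldr _⊔_ 0 f

-- The counted property of a positive integer n: all L_i(n), H_j(n) are positive
-- (so that σ is applied to positive integers) and
-- σ(H_j(n)) > max_i σ(L_i(n)) for every j.
Good : ∀ {k} (a b c d : Fin k → ℤ) → ℕ → Set
Good a b c d n =
  (∀ i → ℤ.0ℤ ℤ.< lin (a i) (b i) (+ n)) ×
  (∀ j → ℤ.0ℤ ℤ.< lin (c j) (d j) (+ n)) ×
  (∀ j → maxFin (λ i → σ ∣ lin (a i) (b i) (+ n) ∣) < σ ∣ lin (c j) (d j) (+ n) ∣)

good? : ∀ {k} (a b c d : Fin k → ℤ) n → Dec (Good a b c d n)
good? a b c d n =
  all? (λ i → ℤ.0ℤ ℤ.<? lin (a i) (b i) (+ n)) ×-dec
  (all? (λ j → ℤ.0ℤ ℤ.<? lin (c j) (d j) (+ n)) ×-dec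
   all? (λ j → maxFin (λ i → σ ∣ lin (a i) (b i) (+ n) ∣) <? σ ∣ lin (c j) (d j) (+ n) ∣))

count : ∀ {k} (a b c d : Fin k → ℤ) → ℕ → ℕ
count a b c d x = length (filter (good? a b c d) (map suc (upTo x)))

{-# OPTIONS --safe #-}

-- The good n even have positive lower density. A common divisor of L_i(n) and H_j(n) divides a_i d_j - b_i c_j ≠ 0, so there is a
-- progression n ≡ w (mod P) along which every L_i(n) is coprime to P while every H_j(n) is a
-- multiple of an "abundant" modulus: a product of many integers 1 + Bt, all of whose multiples h
-- satisfy σ(h) ≥ K h because the harmonic series diverges. Along that progression the divisors of
-- L_i(n) are coprime to P, hence evenly spread, so the mean of σ(L_i(n)) over n ≤ x is O(x).
-- By Markov's inequality, in every window [T, 2T) of the progression at least half of the n have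
-- Σ_i σ(L_i(n)) < K n ≤ σ(H_j(n)) for all j.

module Submission where


module FiniteSums where

  open import Data.Nat
  open import Data.Nat.Properties
  open import Data.Nat.Tactic.RingSolver using (solve-∀)
  open import Data.Product using (_,_)
  open import Relation.Nullary using (Dec; yes; no; ¬_)
  open import Relation.Binary.PropositionalEquality hiding ([_])
  open import Data.Empty using (⊥-elim)
  open import Function using (_∘_)
  open import Relation.Unary using (Pred; Decidable)
  open import Data.List using ([]; _∷_; [_]; _++_; map; filter; length; upTo)
  open import Data.List.Properties using (upTo-∷ʳ; map-++)
  open import Data.Nat.ListAction using (sum)
  open import Data.Nat.ListAction.Properties using (sum-++)

  𝟙 : ∀ {p} {P : Set p} → Dec P → ℕ
  𝟙 (yes _) = 1
  𝟙 (no _)  = 0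

  𝟙-yes : ∀ {p} {P : Set p} (P? : Dec P) → P → 𝟙 P? ≡ 1
  𝟙-yes (yes _) _ = refl
  𝟙-yes (no ¬p) p = ⊥-elim (¬p p)

  𝟙-no : ∀ {p} {P : Set p} (P? : Dec P) → ¬ P → 𝟙 P? ≡ 0
  𝟙-no (yes p) ¬p = ⊥-elim (¬p p)
  𝟙-no (no _)  _  = refl

  ∑ : ℕ → (ℕ → ℕ) → ℕ
  ∑ zero    f = 0
  ∑ (suc n) f = ∑ n f + f n

  -- As with the library's ∑[ i < n ], the body extends only over one application:
  -- ∑[ t < n ] f t + c is (∑[ t < n ] f t) + c.
  syntax ∑ n (λ t → e) = ∑[ t < n ] e

  ∑-cong : ∀ n {f g} → (∀ t → t < n → f t ≡ g t) → ∑ n f ≡ ∑ n g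
  ∑-cong zero    f≡g = refl
  ∑-cong (suc n) f≡g = cong₂ _+_ (∑-cong n (λ t t<n → f≡g t (m<n⇒m<1+n t<n))) (f≡g n ≤-refl)

  ∑-mono-≤ : ∀ n {f g} → (∀ t → t < n → f t ≤ g t) → ∑ n f ≤ ∑ n g
  ∑-mono-≤ zero    f≤g = z≤n
  ∑-mono-≤ (suc n) f≤g = +-mono-≤ (∑-mono-≤ n (λ t t<n → f≤g t (m<n⇒m<1+n t<n))) (f≤g n ≤-refl)

  ∑-distrib-+ : ∀ n f g → ∑[ t < n ] (f t + g t) ≡ ∑ n f + ∑ n g
  ∑-distrib-+ zero    f g = refl
  ∑-distrib-+ (suc n) f g rewrite ∑-distrib-+ n f g = interchange (∑ n f) (∑ n g) (f n) (g n)
    where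
    interchange : ∀ a b c d → a + b + (c + d) ≡ a + c + (b + d)
    interchange = solve-∀

  ∑-distribˡ-* : ∀ c n f → ∑[ t < n ] (c * f t) ≡ c * ∑ n f
  ∑-distribˡ-* c zero    f = sym (*-zeroʳ c)
  ∑-distribˡ-* c (suc n) f rewrite ∑-distribˡ-* c n f = sym (*-distribˡ-+ c (∑ n f) (f n))

  ∑-const : ∀ n c → ∑[ _ < n ] c ≡ n * c
  ∑-const zero    c = refl
  ∑-const (suc n) c rewrite ∑-const n c = +-comm (n * c) c

  ∑-zero : ∀ n → ∑[ _ < n ] 0 ≡ 0
  ∑-zero n = trans (∑-const n 0) (*-zeroʳ n)

  ∑-split : ∀ m n f → ∑ (m + n) f ≡ ∑ m f + ∑[ t < n ] f (m + t)
  ∑-split m zero    f rewrite +-identityʳ m = sym (+-identityʳ (∑ m f))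
  ∑-split m (suc n) f rewrite +-suc m n | ∑-split m n f = +-assoc (∑ m f) _ _

  ∑-monoˡ-≤ : ∀ f {m n} → m ≤ n → ∑ m f ≤ ∑ n f
  ∑-monoˡ-≤ f {m} m≤n with m≤n⇒∃[o]m+o≡n m≤n
  ... | o , refl rewrite ∑-split m o f = m≤m+n (∑ m f) _

  ∑-truncate : ∀ f {m n} → m ≤ n → (∀ t → m ≤ t → t < n → f t ≡ 0) → ∑ n f ≡ ∑ m f
  ∑-truncate f {m} m≤n f≡0 with m≤n⇒∃[o]m+o≡n m≤n
  ... | o , refl = begin
    ∑ (m + o) f                    ≡⟨ ∑-split m o f ⟩
    ∑ m f + ∑[ t < o ] f (m + t)   ≡⟨ cong (∑ m f +_) (∑-cong o (λ t t<o → f≡0 (m + t) (m≤m+n m t) (+-monoʳ-< m t<o))) ⟩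
    ∑ m f + ∑[ _ < o ] 0           ≡⟨ cong (∑ m f +_) (∑-zero o) ⟩
    ∑ m f + 0                      ≡⟨ +-identityʳ (∑ m f) ⟩
    ∑ m f                          ∎
    where open ≡-Reasoning

  ∑-comm : ∀ m n (f : ℕ → ℕ → ℕ) → ∑[ i < m ] ∑[ j < n ] f i j ≡ ∑[ j < n ] ∑[ i < m ] f i j
  ∑-comm zero    n f = sym (∑-zero n)
  ∑-comm (suc m) n f rewrite ∑-comm m n f = sym (∑-distrib-+ n (λ j → ∑[ i < m ] f i j) (λ j → f m j))

  ∑-singleton : ∀ n f t₀ → t₀ < n → (∀ t → t ≢ t₀ → f t ≡ 0) → ∑ n f ≡ f t₀
  ∑-singleton (suc n) f t₀ t₀<1+n f≡0 with t₀ ≟ n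
  ... | yes refl = cong (_+ f t₀) (trans (∑-cong t₀ (λ t t<t₀ → f≡0 t (<⇒≢ t<t₀))) (∑-zero t₀))
  ... | no t₀≢n  = trans (cong₂ _+_ (∑-singleton n f t₀ (≤∧≢⇒< (≤-pred t₀<1+n) t₀≢n) f≡0) (f≡0 n (≢-sym t₀≢n)))
                         (+-identityʳ (f t₀))

  ∑-progression-≤ : ∀ f α β N X → 1 ≤ β → α + β * N ≤ X → ∑[ t < N ] f (α + β * t) ≤ ∑ X f
  ∑-progression-≤ f α β zero    X _   _  = z≤n
  ∑-progression-≤ f α β (suc N) X 1≤β le = begin
    ∑[ t < N ] f (α + β * t) + f (α + β * N) ≤⟨ +-monoˡ-≤ _ (∑-progression-≤ f α β N (α + β * N) 1≤β ≤-refl) ⟩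
    ∑ (suc (α + β * N)) f                     ≤⟨ ∑-monoˡ-≤ f next≤X ⟩
    ∑ X f                                     ∎
    where
    open ≤-Reasoning
    next≤X : suc (α + β * N) ≤ X
    next≤X = begin
      suc (α + β * N) ≡⟨ +-suc α (β * N) ⟨
      α + suc (β * N) ≤⟨ +-monoʳ-≤ α (+-monoˡ-≤ (β * N) 1≤β) ⟩
      α + (β + β * N) ≡⟨ cong (α +_) (*-suc β N) ⟨
      α + β * suc N   ≤⟨ le ⟩
      X               ∎

  ∑-shift-≤ : ∀ f M N → ∑[ t < N ] f (M + t) ≤ ∑ (M + N) f
  ∑-shift-≤ f M N = ≤-trans (m≤n+m _ (∑ M f)) (≤-reflexive (sym (∑-split M N f)))

  count< : ∀ {q} {Q : ℕ → Set q} → (∀ t → Dec (Q t)) → ℕ → ℕ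
  count< Q? T = ∑[ t < T ] 𝟙 (Q? t)

  module _ {q} {Q : ℕ → Set q} (Q? : ∀ t → Dec (Q t)) where

    count<-hit : ∀ {T} → Q T → count< Q? (suc T) ≡ suc (count< Q? T)
    count<-hit {T} QT = trans (cong (count< Q? T +_) (𝟙-yes (Q? T) QT)) (+-comm (count< Q? T) 1)

    count<-miss : ∀ {T} → ¬ Q T → count< Q? (suc T) ≡ count< Q? T
    count<-miss {T} ¬QT = trans (cong (count< Q? T +_) (𝟙-no (Q? T) ¬QT)) (+-identityʳ (count< Q? T))

    count<-cover : ∀ {p} {P : ℕ → Set p} (P? : ∀ t → Dec (P t)) N →
                   (∀ t → t < N → ¬ Q t → P t) → N ≤ count< P? N + count< Q? N
    count<-cover {P = P} P? N ¬Q⇒P = begin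
      N                                   ≡⟨ trans (∑-const N 1) (*-identityʳ N) ⟨
      ∑[ _ < N ] 1                        ≤⟨ ∑-mono-≤ N (λ t t<N → one-of t (¬Q⇒P t t<N)) ⟩
      ∑[ t < N ] (𝟙 (P? t) + 𝟙 (Q? t))    ≡⟨ ∑-distrib-+ N _ _ ⟩
      count< P? N + count< Q? N           ∎
      where
      open ≤-Reasoning
      one-of : ∀ t → (¬ Q t → P t) → 1 ≤ 𝟙 (P? t) + 𝟙 (Q? t)
      one-of t ¬Qt⇒Pt with P? t | Q? t
      ... | yes _ | _     = s≤s z≤n
      ... | no  _ | yes _ = s≤s z≤n
      ... | no ¬Pt | no ¬Qt = ⊥-elim (¬Pt (¬Qt⇒Pt ¬Qt))

  markov : ∀ (F : ℕ → ℕ) Y N → count< (λ t → Y ≤? F t) N * Y ≤ ∑ N F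
  markov F Y N = begin
    count< (λ t → Y ≤? F t) N * Y     ≡⟨ *-comm _ Y ⟩
    Y * count< (λ t → Y ≤? F t) N     ≡⟨ ∑-distribˡ-* Y N _ ⟨
    ∑[ t < N ] (Y * 𝟙 (Y ≤? F t))     ≤⟨ ∑-mono-≤ N (λ t _ → large t) ⟩
    ∑ N F                             ∎
    where
    open ≤-Reasoning
    large : ∀ t → Y * 𝟙 (Y ≤? F t) ≤ F t
    large t with Y ≤? F t
    ... | yes Y≤Ft = ≤-trans (≤-reflexive (*-identityʳ Y)) Y≤Ft
    ... | no  _    = ≤-trans (≤-reflexive (*-zeroʳ Y)) z≤n

  sum-map-upTo : ∀ f n → sum (map f (upTo n)) ≡ ∑ n f
  sum-map-upTo f zero    = refl
  sum-map-upTo f (suc n) = begin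
    sum (map f (upTo (suc n)))        ≡⟨ cong (sum ∘ map f) (upTo-∷ʳ n) ⟨
    sum (map f (upTo n ++ [ n ]))     ≡⟨ cong sum (map-++ f (upTo n) [ n ]) ⟩
    sum (map f (upTo n) ++ [ f n ])   ≡⟨ sum-++ (map f (upTo n)) [ f n ] ⟩
    sum (map f (upTo n)) + (f n + 0)  ≡⟨ cong₂ _+_ (sum-map-upTo f n) (+-identityʳ (f n)) ⟩
    ∑ (suc n) f                       ∎
    where open ≡-Reasoning

  sum-filter : ∀ {p} {P : Pred ℕ p} (P? : Decidable P) xs →
               sum (filter P? xs) ≡ sum (map (λ x → 𝟙 (P? x) * x) xs)
  sum-filter P? []       = refl
  sum-filter P? (x ∷ xs) with P? x
  ... | yes _ = cong₂ _+_ (sym (+-identityʳ x)) (sum-filter P? xs)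
  ... | no  _ = sum-filter P? xs

  length-filter : ∀ {p} {P : Pred ℕ p} (P? : Decidable P) xs →
                  length (filter P? xs) ≡ sum (map (𝟙 ∘ P?) xs)
  length-filter P? []       = refl
  length-filter P? (x ∷ xs) with P? x
  ... | yes _ = cong suc (length-filter P? xs)
  ... | no  _ = length-filter P? xs


module FinSums where

  open import Data.Nat
  open import Data.Nat.Properties
  open import Data.Fin using (Fin; zero; suc)
  import Data.Vec.Functional as Vector
  open import Relation.Binary.PropositionalEquality
  open import Defs using (maxFin)
  open FiniteSums

  sumFin : ∀ {k} → (Fin k → ℕ) → ℕ
  sumFin = Vector.foldr _+_ 0

  sumFin-≥ : ∀ {k} (f : Fin k → ℕ) i → f i ≤ sumFin f
  sumFin-≥ f zero    = m≤m+n (f zero) _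
  sumFin-≥ f (suc i) = ≤-trans (sumFin-≥ (λ j → f (suc j)) i) (m≤n+m _ (f zero))

  sumFin-mono-≤ : ∀ {k} {f g : Fin k → ℕ} → (∀ i → f i ≤ g i) → sumFin f ≤ sumFin g
  sumFin-mono-≤ {zero}  f≤g = z≤n
  sumFin-mono-≤ {suc k} f≤g = +-mono-≤ (f≤g zero) (sumFin-mono-≤ (λ i → f≤g (suc i)))

  sumFin-const : ∀ k c → sumFin {k} (λ _ → c) ≡ k * c
  sumFin-const zero    c = refl
  sumFin-const (suc k) c = cong (c +_) (sumFin-const k c)

  ∑-sumFin : ∀ {k} N (f : Fin k → ℕ → ℕ) → ∑[ t < N ] sumFin (λ i → f i t) ≡ sumFin (λ i → ∑ N (f i))
  ∑-sumFin {zero}  N f = ∑-zero N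
  ∑-sumFin {suc k} N f = trans (∑-distrib-+ N (f zero) (λ t → sumFin (λ i → f (suc i) t)))
                               (cong (∑ N (f zero) +_) (∑-sumFin N (λ i → f (suc i))))

  maxFin≤sumFin : ∀ {k} (f : Fin k → ℕ) → maxFin f ≤ sumFin f
  maxFin≤sumFin {zero}  f = z≤n
  maxFin≤sumFin {suc k} f = ≤-trans (m⊔n≤m+n (f zero) _) (+-monoʳ-≤ (f zero) (maxFin≤sumFin (λ i → f (suc i))))


module DivisorSums where

  open import Data.Nat
  open import Data.Nat.Properties
  open import Data.Nat.Divisibility using (_∣_; _∣?_; divides)
  open import Data.Nat.DivMod using (_/_; m*n/n≡m; /-congˡ; m<n⇒m/n≡0)
  open import Data.List using (map; filter; upTo)
  open import Data.List.Properties using (map-∘)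
  open import Data.Nat.ListAction using (sum)
  open import Function using (id; _∘′_)
  open import Relation.Nullary using (yes; no)
  open import Relation.Binary.PropositionalEquality
  open import Defs using (σ)
  open FiniteSums

  ∑-cofactor : ∀ n m .{{_ : NonZero n}} .{{_ : NonZero m}} (v : ℕ → ℕ) →
               ∑[ q < n ] (𝟙 (suc q * m ≟ n) * v (suc q)) ≡ 𝟙 (m ∣? n) * v (n / m)
  ∑-cofactor n m v with m ∣? n
  ... | no m∤n = trans (∑-cong n (λ q _ → cong (_* v (suc q)) (𝟙-no (suc q * m ≟ n) (m∤n ∘′ divides (suc q) ∘′ sym))))
                       (∑-zero n)
  ∑-cofactor (suc _) m v | yes (divides (suc q₀) n≡[1+q₀]m) = begin
    ∑[ q < n ] (𝟙 (suc q * m ≟ n) * v (suc q)) ≡⟨ ∑-singleton n _ q₀ q₀<n others ⟩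
    𝟙 (suc q₀ * m ≟ n) * v (suc q₀)          ≡⟨ cong (_* v (suc q₀)) (𝟙-yes (suc q₀ * m ≟ n) (sym n≡[1+q₀]m)) ⟩
    1 * v (suc q₀)                           ≡⟨ cong (λ q → 1 * v q) n/m≡1+q₀ ⟨
    1 * v (n / m)                            ∎
    where
    open ≡-Reasoning
    n = suc _
    n/m≡1+q₀ : n / m ≡ suc q₀
    n/m≡1+q₀ = trans (/-congˡ n≡[1+q₀]m) (m*n/n≡m (suc q₀) m)
    q₀<n : q₀ < n
    q₀<n = ≤-trans (m≤m*n (suc q₀) m) (≤-reflexive (sym n≡[1+q₀]m))
    others : ∀ q → q ≢ q₀ → 𝟙 (suc q * m ≟ n) * v (suc q) ≡ 0
    others q q≢q₀ = cong (_* v (suc q)) (𝟙-no (suc q * m ≟ n)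
      (λ eq → q≢q₀ (suc-injective (*-cancelʳ-≡ (suc q) (suc q₀) m (trans eq n≡[1+q₀]m)))))

  σ≡∑-divisors : ∀ n → σ n ≡ ∑[ d < n ] (𝟙 (suc d ∣? n) * suc d)
  σ≡∑-divisors n = begin
    sum (filter (_∣? n) (map suc (upTo n)))                ≡⟨ sum-filter (_∣? n) (map suc (upTo n)) ⟩
    sum (map (λ d → 𝟙 (d ∣? n) * d) (map suc (upTo n)))    ≡⟨ cong sum (map-∘ (upTo n)) ⟨
    sum (map (λ d → 𝟙 (suc d ∣? n) * suc d) (upTo n))      ≡⟨ sum-map-upTo _ n ⟩
    ∑[ d < n ] (𝟙 (suc d ∣? n) * suc d)                    ∎
    where open ≡-Reasoning

  -- Each divisor d is paired with its cofactor n / d by exchanging a double sum over d * e = n.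
  σ≡∑-codivisors : ∀ n X → n ≤ X → σ n ≡ ∑[ e < X ] (𝟙 (suc e ∣? n) * (n / suc e))
  σ≡∑-codivisors zero X _ = sym (trans (∑-cong X (λ e _ → *-zeroʳ (𝟙 (suc e ∣? 0)))) (∑-zero X))
  σ≡∑-codivisors n@(suc _) X n≤X = begin
    σ n                                                   ≡⟨ σ≡∑-divisors n ⟩
    ∑[ d < n ] (𝟙 (suc d ∣? n) * suc d)                   ≡⟨ ∑-cong n (λ d _ → ∑-cofactor n (suc d) (λ _ → suc d)) ⟨
    ∑[ d < n ] ∑[ e < n ] (𝟙 (suc e * suc d ≟ n) * suc d) ≡⟨ ∑-comm n n _ ⟩
    ∑[ e < n ] ∑[ d < n ] (𝟙 (suc e * suc d ≟ n) * suc d) ≡⟨ ∑-cong n (λ e _ → ∑-cong n (λ d _ → swap e d)) ⟩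
    ∑[ e < n ] ∑[ d < n ] (𝟙 (suc d * suc e ≟ n) * suc d) ≡⟨ ∑-cong n (λ e _ → ∑-cofactor n (suc e) id) ⟩
    ∑[ e < n ] (𝟙 (suc e ∣? n) * (n / suc e))             ≡⟨ ∑-truncate _ n≤X beyond-n ⟨
    ∑[ e < X ] (𝟙 (suc e ∣? n) * (n / suc e))             ∎
    where
    open ≡-Reasoning
    swap : ∀ e d → 𝟙 (suc e * suc d ≟ n) * suc d ≡ 𝟙 (suc d * suc e ≟ n) * suc d
    swap e d = cong (λ x → 𝟙 (x ≟ n) * suc d) (*-comm (suc e) (suc d))
    beyond-n : ∀ e → n ≤ e → e < X → 𝟙 (suc e ∣? n) * (n / suc e) ≡ 0
    beyond-n e n≤e _ = trans (cong (𝟙 (suc e ∣? n) *_) (m<n⇒m/n≡0 (s≤s n≤e))) (*-zeroʳ (𝟙 (suc e ∣? n)))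

  ∑-codivisors≤σ : ∀ h α β N → 1 ≤ β → (∀ t → t < N → suc (α + β * t) ∣ h) →
                   ∑[ t < N ] (h / suc (α + β * t)) ≤ σ h
  ∑-codivisors≤σ h α β N 1≤β divides-h = begin
    ∑[ t < N ] (h / suc (α + β * t))  ≡⟨ ∑-cong N (λ t t<N → codivisor-hit (α + β * t) (divides-h t t<N)) ⟨
    ∑[ t < N ] codivisor (α + β * t)  ≤⟨ ∑-progression-≤ codivisor α β N X 1≤β (m≤n+m _ h) ⟩
    ∑[ e < X ] codivisor e            ≡⟨ σ≡∑-codivisors h X (m≤m+n h _) ⟨
    σ h                               ∎
    where
    open ≤-Reasoning
    X = h + (α + β * N)
    codivisor : ℕ → ℕ
    codivisor e = 𝟙 (suc e ∣? h) * (h / suc e)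
    codivisor-hit : ∀ e → suc e ∣ h → codivisor e ≡ h / suc e
    codivisor-hit e e+1∣h = trans (cong (_* (h / suc e)) (𝟙-yes (suc e ∣? h) e+1∣h)) (*-identityˡ (h / suc e))


module QuotientSums where

  open import Data.Nat
  open import Data.Nat.Properties
  open import Data.Nat.DivMod
  open import Data.Nat.Tactic.RingSolver using (solve-∀)
  open import Relation.Binary.PropositionalEquality
  open FiniteSums

  m<[1+m/n]*n : ∀ m n .{{_ : NonZero n}} → m < suc (m / n) * n
  m<[1+m/n]*n m n = begin-strict
    m                   ≡⟨ m≡m%n+[m/n]*n m n ⟩
    m % n + (m / n) * n <⟨ +-monoˡ-< _ (m%n<n m n) ⟩
    n + (m / n) * n     ∎
    where open ≤-Reasoning

  m*n≤o⇒m≤o/n : ∀ m n o .{{_ : NonZero n}} → m * n ≤ o → m ≤ o / n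
  m*n≤o⇒m≤o/n m n o m*n≤o = ≤-trans (≤-reflexive (sym (m*n/n≡m m n))) (/-monoˡ-≤ n m*n≤o)

  [m+n]/o≤m/o+n/o+1 : ∀ m n o .{{_ : NonZero o}} → (m + n) / o ≤ m / o + n / o + 1
  [m+n]/o≤m/o+n/o+1 m n o = ≤-pred (m<n*o⇒m/o<n (begin-strict
    m + n                              <⟨ +-mono-<-≤ (m<[1+m/n]*n m o) (<⇒≤ (m<[1+m/n]*n n o)) ⟩
    suc (m / o) * o + suc (n / o) * o  ≡⟨ collect (m / o) (n / o) o ⟩
    suc (m / o + n / o + 1) * o        ∎))
    where
    open ≤-Reasoning
    collect : ∀ x y o → suc x * o + suc y * o ≡ suc (x + y + 1) * o
    collect = solve-∀

  m*n²≤o+p*n⇒m≤o/n²+p/n+1 : ∀ m n o p .{{_ : NonZero n}} .{{_ : NonZero (n * n)}} →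
                            m * (n * n) ≤ o + p * n → m ≤ o / (n * n) + p / n + 1
  m*n²≤o+p*n⇒m≤o/n²+p/n+1 m n o p hyp = begin
    m                                  ≤⟨ m*n≤o⇒m≤o/n m (n * n) (o + p * n) hyp ⟩
    (o + p * n) / (n * n)              ≤⟨ [m+n]/o≤m/o+n/o+1 o (p * n) (n * n) ⟩
    o / (n * n) + p * n / (n * n) + 1  ≡⟨ cong (λ q → o / (n * n) + q + 1) (m*n/o*n≡m/o p n n) ⟩
    o / (n * n) + p / n + 1            ∎
    where open ≤-Reasoning

  -- The floor-division form of 1/(n(n+1)) = 1/n - 1/(n+1), which telescopes below.
  m/[[1+n][2+n]]+m/[2+n]≤m/[1+n] : ∀ m n → m / (suc n * suc (suc n)) + m / suc (suc n) ≤ m / suc n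
  m/[[1+n][2+n]]+m/[2+n]≤m/[1+n] m n = ≤-pred (*-cancelʳ-< (suc n′) _ _ (begin-strict
    (m / (n′ * suc n′) + m / suc n′) * suc n′ ≡⟨ *-distribʳ-+ (suc n′) (m / (n′ * suc n′)) (m / suc n′) ⟩
    m / (n′ * suc n′) * suc n′ + m / suc n′ * suc n′
      ≤⟨ +-mono-≤ (≤-trans (≤-reflexive (cong (_* suc n′) (sym (m/n/o≡m/[n*o] m n′ (suc n′))))) (m/n*n≤m (m / n′) (suc n′)))
                  (m/n*n≤m m (suc n′)) ⟩
    m / n′ + m                             <⟨ +-monoʳ-< (m / n′) (m<[1+m/n]*n m n′) ⟩
    m / n′ + suc (m / n′) * n′             <⟨ +-monoˡ-< (suc (m / n′) * n′) (n<1+n (m / n′)) ⟩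
    suc (m / n′) + suc (m / n′) * n′       ≡⟨ *-suc (suc (m / n′)) n′ ⟨
    suc (m / n′) * suc n′                  ∎))
    where
    open ≤-Reasoning
    n′ = suc n

  ∑-/[1+e]²≤2* : ∀ m N → ∑[ e < N ] (m / (suc e * suc e)) ≤ 2 * m
  ∑-/[1+e]²≤2* m zero    = z≤n
  ∑-/[1+e]²≤2* m (suc N) = ≤-trans (m≤m+n _ _) (telescope N)
    where
    sq : ℕ → ℕ
    sq e = m / (suc e * suc e)
    telescope : ∀ n → ∑ (suc n) sq + m / suc n ≤ 2 * m
    telescope zero    = ≤-reflexive (cong₂ _+_ (n/1≡n m) (trans (n/1≡n m) (sym (+-identityʳ m))))
    telescope (suc n) = begin
      ∑ (suc n) sq + sq (suc n) + m / suc (suc n)   ≡⟨ +-assoc (∑ (suc n) sq) _ _ ⟩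
      ∑ (suc n) sq + (sq (suc n) + m / suc (suc n)) ≤⟨ +-monoʳ-≤ (∑ (suc n) sq) step ⟩
      ∑ (suc n) sq + m / suc n                      ≤⟨ telescope n ⟩
      2 * m                                         ∎
      where
      open ≤-Reasoning
      step : sq (suc n) + m / suc (suc n) ≤ m / suc n
      step = ≤-trans (+-monoˡ-≤ _ (/-monoʳ-≤ m (*-monoˡ-≤ (suc (suc n)) (n≤1+n (suc n)))))
                     (m/[[1+n][2+n]]+m/[2+n]≤m/[1+n] m n)

  -- A logarithm-free substitute for ∑[ e < N ] m / (1 + e) ≈ m log N.
  ∑-/[1+e]≤ : ∀ m s N → ∑[ e < N ] (m / suc e) ≤ s * m + N * (m / suc s)
  ∑-/[1+e]≤ m s N = begin
    ∑[ e < N ] (m / suc e)                                 ≤⟨ ∑-monoˡ-≤ _ (m≤n+m N s) ⟩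
    ∑ (s + N) (λ e → m / suc e)                            ≡⟨ ∑-split s N _ ⟩
    ∑[ e < s ] (m / suc e) + ∑[ e < N ] (m / suc (s + e))  ≤⟨ +-mono-≤ head tail ⟩
    s * m + N * (m / suc s)                                ∎
    where
    open ≤-Reasoning
    head : ∑[ e < s ] (m / suc e) ≤ s * m
    head = ≤-trans (∑-mono-≤ s (λ e _ → m/n≤m m (suc e))) (≤-reflexive (∑-const s m))
    tail : ∑[ e < N ] (m / suc (s + e)) ≤ N * (m / suc s)
    tail = ≤-trans (∑-mono-≤ N (λ e _ → /-monoʳ-≤ m (s≤s (m≤m+n s e)))) (≤-reflexive (∑-const N _))


module AbundantModuli where

  open import Data.Nat
  open import Data.Nat.Properties
  open import Data.Nat.DivMod using (_/_; m/n*n≡m)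
  open import Data.Nat.Divisibility using (_∣_; ∣-trans; n∣m*n; ∣m⇒∣m*n)
  open import Data.Nat.Tactic.RingSolver using (solve-∀)
  open import Data.Product using (∃; _,_; proj₁; proj₂)
  open import Relation.Nullary using (yes; no)
  open import Relation.Binary.PropositionalEquality
  open import Defs using (σ)
  open FiniteSums
  open DivisorSums using (∑-codivisors≤σ)

  -- ∑[ t < 2 ^ m ] 1 / (1 + t) ≥ m / 2, as each dyadic block [2 ^ j, 2 ^ (1 + j)) contributes at
  -- least 1/2; stated for terms q t ≥ h / (c (1 + t)).
  dyadic-harmonic : ∀ m (q : ℕ → ℕ) c h → (∀ t → t < 2 ^ m → h ≤ q t * c * suc t) → m * h ≤ 2 * c * ∑ (2 ^ m) q
  dyadic-harmonic zero    q c h _   = z≤n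
  dyadic-harmonic (suc m) q c h hyp = begin
    h + m * h                                     ≤⟨ +-mono-≤ upper-half (dyadic-harmonic m q c h (λ t t<P → hyp t (≤-trans t<P (m≤m+n P _)))) ⟩
    2 * c * ∑[ t < P ] q (P + t) + 2 * c * ∑ P q  ≡⟨ *-distribˡ-+ (2 * c) _ (∑ P q) ⟨
    2 * c * (∑[ t < P ] q (P + t) + ∑ P q)        ≡⟨ cong (2 * c *_) (trans (+-comm _ (∑ P q)) (sym (∑-split P P q))) ⟩
    2 * c * ∑ (P + P) q                           ≡⟨ cong (λ n → 2 * c * ∑ (P + n) q) (+-identityʳ P) ⟨
    2 * c * ∑ (2 ^ suc m) q                       ∎
    where
    open ≤-Reasoning
    P = 2 ^ m
    instance
      P≢0 : NonZero P
      P≢0 = m^n≢0 2 m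
    1+P+t≤2P : ∀ t → t < P → suc (P + t) ≤ 2 * P
    1+P+t≤2P t t<P = begin
      suc (P + t) ≡⟨ +-suc P t ⟨
      P + suc t   ≤⟨ +-monoʳ-≤ P t<P ⟩
      P + P       ≡⟨ cong (P +_) (+-identityʳ P) ⟨
      2 * P       ∎
    upper-half : h ≤ 2 * c * ∑[ t < P ] q (P + t)
    upper-half = *-cancelˡ-≤ P (begin
      P * h                                  ≡⟨ ∑-const P h ⟨
      ∑[ _ < P ] h                           ≤⟨ ∑-mono-≤ P (λ t t<P → ≤-trans (hyp (P + t) (1+P+t≤2P t t<P))
                                                                            (*-monoʳ-≤ (q (P + t) * c) (1+P+t≤2P t t<P))) ⟩
      ∑[ t < P ] (q (P + t) * c * (2 * P))   ≡⟨ ∑-cong P (λ t _ → regroup (q (P + t)) c P) ⟩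
      ∑[ t < P ] (P * (2 * c) * q (P + t))   ≡⟨ ∑-distribˡ-* (P * (2 * c)) P _ ⟩
      P * (2 * c) * ∑[ t < P ] q (P + t)     ≡⟨ *-assoc P (2 * c) _ ⟩
      P * (2 * c * ∑[ t < P ] q (P + t))     ∎)
      where
      regroup : ∀ x c P → x * c * (2 * P) ≡ P * (2 * c) * x
      regroup = solve-∀

  ∏ : ℕ → (ℕ → ℕ) → ℕ
  ∏ zero    f = 1
  ∏ (suc n) f = ∏ n f * f n

  syntax ∏ n (λ t → e) = ∏[ t < n ] e

  ∣∏ : ∀ n f t → t < n → f t ∣ ∏ n f
  ∣∏ (suc n) f t t<1+n with t ≟ n
  ... | yes refl = n∣m*n (∏ t f)
  ... | no  t≢n  = ∣m⇒∣m*n (f n) (∣∏ n f t (≤∧≢⇒< (≤-pred t<1+n) t≢n))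

  ∏-1+B* : ∀ B (v : ℕ → ℕ) n → ∃ λ u → ∏[ t < n ] (1 + B * v t) ≡ 1 + B * u
  ∏-1+B* B v zero    = 0 , cong suc (sym (*-zeroʳ B))
  ∏-1+B* B v (suc n) with ∏-1+B* B v n
  ... | u , ∏≡1+Bu = u + v n + B * u * v n , trans (cong (_* (1 + B * v n)) ∏≡1+Bu) (expand B u (v n))
    where
    expand : ∀ b u v → (1 + b * u) * (1 + b * v) ≡ 1 + b * (u + v + b * u * v)
    expand = solve-∀

  -- The modulus is ∏[ t < N ] (1 + B (1 + t)) with N = 2 ^ (4 B K): a multiple h of it has the
  -- distinct codivisors h / (1 + B (1 + t)) ≥ h / (2 B (1 + t)), which sum to at least K h.
  abundant-modulus : ∀ B K → 1 ≤ B → ∃ λ u → ∀ h .{{_ : NonZero h}} → 1 + B * u ∣ h → K * h ≤ σ h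
  abundant-modulus B K 1≤B = u , abundant
    where
    N = 2 ^ (4 * B * K)
    u = proj₁ (∏-1+B* B suc N)
    abundant : ∀ h .{{_ : NonZero h}} → 1 + B * u ∣ h → K * h ≤ σ h
    abundant h A∣h = *-cancelˡ-≤ (4 * B) {{4B≢0}} (begin
      4 * B * (K * h)            ≡⟨ *-assoc (4 * B) K h ⟨
      4 * B * K * h              ≤⟨ dyadic-harmonic (4 * B * K) q (2 * B) h harmonic ⟩
      2 * (2 * B) * ∑ N q        ≡⟨ cong (_* ∑ N q) (*-assoc 2 2 B) ⟨
      4 * B * ∑ N q              ≤⟨ *-monoʳ-≤ (4 * B) (∑-codivisors≤σ h B B N 1≤B divides-h) ⟩
      4 * B * σ h                ∎)
      where
      open ≤-Reasoning
      4B≢0 : NonZero (4 * B)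
      4B≢0 = m*n≢0 4 B {{_}} {{>-nonZero 1≤B}}
      divides-h : ∀ t → t < N → suc (B + B * t) ∣ h
      divides-h t t<N = subst (λ d → suc d ∣ h) (*-suc B t)
        (∣-trans (∣∏ N (λ t → 1 + B * suc t) t t<N) (subst (_∣ h) (sym (proj₂ (∏-1+B* B suc N))) A∣h))
      q : ℕ → ℕ
      q t = h / suc (B + B * t)
      harmonic : ∀ t → t < N → h ≤ q t * (2 * B) * suc t
      harmonic t t<N = begin
        h                              ≡⟨ m/n*n≡m (divides-h t t<N) ⟨
        q t * suc (B + B * t)          ≤⟨ *-monoʳ-≤ (q t) (≤-trans (+-monoˡ-≤ (B + B * t) 1≤B) (m≤m+n _ (B * t))) ⟩
        q t * (B + (B + B * t) + B * t) ≡⟨ regroup (q t) B t ⟩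
        q t * (2 * B) * suc t          ∎
        where
        regroup : ∀ x B t → x * (B + (B + B * t) + B * t) ≡ x * (2 * B) * suc t
        regroup = solve-∀


module SeparatedSets where

  open import Data.Nat
  open import Data.Nat.Properties
  open import Function using (case_of_)
  open import Relation.Nullary using (Dec; yes; no)
  open import Relation.Binary.PropositionalEquality
  open FiniteSums

  module _ {q} {Q : ℕ → Set q} (Q? : ∀ t → Dec (Q t)) (a E : ℕ)
           (separated : ∀ {t t′} → t < t′ → Q t → Q t′ → a * t + E ≤ a * t′) where

    count-below-member : ∀ T t′ → T ≤ t′ → Q t′ → count< Q? T * E ≤ a * t′
    count-up-to-member : ∀ T → Q T → count< Q? (suc T) * E ≤ a * T + E

    count-below-member zero    t′ _      _   = z≤n
    count-below-member (suc T) t′ 1+T≤t′ Qt′ = case Q? T of λ where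
      (yes QT)  → ≤-trans (count-up-to-member T QT) (separated 1+T≤t′ QT Qt′)
      (no  ¬QT) → subst (λ c → c * E ≤ a * t′) (sym (count<-miss Q? ¬QT)) (count-below-member T t′ (<⇒≤ 1+T≤t′) Qt′)

    count-up-to-member T QT = begin
      count< Q? (suc T) * E     ≡⟨ cong (_* E) (count<-hit Q? QT) ⟩
      E + count< Q? T * E       ≡⟨ +-comm E (count< Q? T * E) ⟩
      count< Q? T * E + E       ≤⟨ +-monoˡ-≤ E (count-below-member T T ≤-refl QT) ⟩
      a * T + E                 ∎
      where open ≤-Reasoning

    count-separated : ∀ T → count< Q? T * E ≤ a * T + E
    count-separated zero    = z≤n
    count-separated (suc T) = ≤-trans up-to-T (+-monoˡ-≤ E (*-monoʳ-≤ a (n≤1+n T)))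
      where
      up-to-T : count< Q? (suc T) * E ≤ a * T + E
      up-to-T = case Q? T of λ where
        (yes QT)  → count-up-to-member T QT
        (no  ¬QT) → subst (λ c → c * E ≤ a * T + E) (sym (count<-miss Q? ¬QT)) (count-separated T)


module DivisorSumsInProgressions where

  open import Data.Nat
  open import Data.Nat.Properties
  open import Data.Nat.DivMod using (_/_; m/n*n≤m; /-monoˡ-≤)
  open import Data.Nat.Divisibility using (_∣_; _∣?_; ∣⇒≤; ∣-trans; ∣m+n∣m⇒∣n)
  open import Data.Nat.Coprimality using (Coprime; coprime-divisor)
  open import Data.Nat.Tactic.RingSolver using (solve-∀)
  open import Data.Product using (_,_)
  open import Relation.Binary.PropositionalEquality
  open import Defs using (σ)
  open FiniteSums
  open DivisorSums using (σ≡∑-codivisors)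
  open QuotientSums
  open SeparatedSets

  module _ (α a P : ℕ) (1≤a : 1 ≤ a) (coprime : ∀ t → Coprime (α + a * P * t) P) where

    private
      m : ℕ → ℕ
      m t = α + a * P * t

    multiples-separated : ∀ E → 1 ≤ E → ∀ {t t′} → t < t′ → E ∣ m t → E ∣ m t′ → a * t + E ≤ a * t′
    multiples-separated E 1≤E {t} {t′} t<t′ E∣mt E∣mt′ = begin
      a * t + E       ≤⟨ +-monoʳ-≤ (a * t) E≤ad ⟩
      a * t + a * d   ≡⟨ *-distribˡ-+ a t d ⟨
      a * (t + d)     ≡⟨ cong (a *_) (m+[n∸m]≡n (<⇒≤ t<t′)) ⟩
      a * t′          ∎
      where
      open ≤-Reasoning
      d = t′ ∸ t
      mt′≡mt+Pad : m t′ ≡ m t + P * (a * d)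
      mt′≡mt+Pad = trans (cong m (sym (m+[n∸m]≡n (<⇒≤ t<t′)))) (expand α a P t d)
        where
        expand : ∀ α a P t d → α + a * P * (t + d) ≡ α + a * P * t + P * (a * d)
        expand = solve-∀
      E≤ad : E ≤ a * d
      E≤ad = ∣⇒≤ {{>-nonZero (*-mono-≤ 1≤a (m<n⇒0<n∸m t<t′))}}
        (coprime-divisor (λ (i∣E , i∣P) → coprime t (∣-trans i∣E E∣mt , i∣P))
                         (∣m+n∣m⇒∣n (subst (E ∣_) mt′≡mt+Pad E∣mt′) E∣mt))

    -- With σ m = ∑ m / e over the divisors e of m, a given e divides at most a T / e + 1 of the
    -- terms, because they are coprime to P.
    ∑σ-progression≤ : ∀ T X s → m T ≤ X → ∑[ t < T ] σ (m t) ≤ X * (2 * (a * T) + s + X / suc s + 1)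
    ∑σ-progression≤ T X s mT≤X = begin
      ∑[ t < T ] σ (m t)
        ≡⟨ ∑-cong T (λ t t<T → σ≡∑-codivisors (m t) X (m≤X t<T)) ⟩
      ∑[ t < T ] ∑[ e < X ] (𝟙 (suc e ∣? m t) * (m t / suc e))
        ≤⟨ ∑-mono-≤ T (λ t t<T → ∑-mono-≤ X (λ e _ → *-monoʳ-≤ (𝟙 (suc e ∣? m t)) (/-monoˡ-≤ (suc e) (m≤X t<T)))) ⟩
      ∑[ t < T ] ∑[ e < X ] (𝟙 (suc e ∣? m t) * (X / suc e))
        ≡⟨ ∑-comm T X _ ⟩
      ∑[ e < X ] ∑[ t < T ] (𝟙 (suc e ∣? m t) * (X / suc e))
        ≡⟨ ∑-cong X (λ e _ → trans (∑-cong T (λ t _ → *-comm (𝟙 (suc e ∣? m t)) (X / suc e))) (∑-distribˡ-* (X / suc e) T _)) ⟩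
      ∑[ e < X ] (X / suc e * multiples e)
        ≤⟨ ∑-mono-≤ X (λ e _ → codivisor-bound e) ⟩
      ∑[ e < X ] (U / (suc e * suc e) + X / suc e + 1)
        ≡⟨ trans (∑-distrib-+ X _ (λ _ → 1)) (cong₂ _+_ (∑-distrib-+ X _ _) (trans (∑-const X 1) (*-identityʳ X))) ⟩
      ∑[ e < X ] (U / (suc e * suc e)) + ∑[ e < X ] (X / suc e) + X
        ≤⟨ +-monoˡ-≤ X (+-mono-≤ (∑-/[1+e]²≤2* U X) (∑-/[1+e]≤ X s X)) ⟩
      2 * U + (s * X + X * (X / suc s)) + X
        ≡⟨ collect X (a * T) s (X / suc s) ⟩
      X * (2 * (a * T) + s + X / suc s + 1)
        ∎
      where
      open ≤-Reasoning
      U = X * (a * T)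
      m≤X : ∀ {t} → t < T → m t ≤ X
      m≤X t<T = ≤-trans (+-monoʳ-≤ α (*-monoʳ-≤ (a * P) (<⇒≤ t<T))) mT≤X
      multiples : ℕ → ℕ
      multiples e = count< (λ t → suc e ∣? m t) T
      codivisor-bound : ∀ e → X / suc e * multiples e ≤ U / (suc e * suc e) + X / suc e + 1
      codivisor-bound e = m*n²≤o+p*n⇒m≤o/n²+p/n+1 _ (suc e) U X (begin
        X / suc e * multiples e * (suc e * suc e)   ≡⟨ regroup (X / suc e) (multiples e) (suc e) ⟩
        X / suc e * suc e * (multiples e * suc e)   ≤⟨ *-mono-≤ (m/n*n≤m X (suc e))
                                                         (count-separated _ a (suc e) (multiples-separated (suc e) (s≤s z≤n)) T) ⟩
        X * (a * T + suc e)                         ≡⟨ *-distribˡ-+ X (a * T) (suc e) ⟩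
        U + X * suc e                               ∎)
        where
        regroup : ∀ x c E → x * c * (E * E) ≡ x * E * (c * E)
        regroup = solve-∀
      collect : ∀ X b s z → 2 * (X * b) + (s * X + X * z) + X ≡ X * (2 * b + s + z + 1)
      collect = solve-∀


module NaturalLinearForms where

  open import Data.Nat
  open import Data.Nat.Properties
  open import Data.Nat.Divisibility using (_∣_; ∣m+n∣m⇒∣n; ∣n⇒∣m*n)
  open import Data.Nat.Tactic.RingSolver using (solve-∀)
  open import Data.Sum using (inj₁; inj₂)
  open import Relation.Binary.PropositionalEquality

  lin⁺ : ℕ → ℕ → ℕ → ℕ
  lin⁺ a b m = a * m + b

  ∣m∣n⇒∣∣m-n∣ : ∀ {d m n} → d ∣ m → d ∣ n → d ∣ ∣ m - n ∣
  ∣m∣n⇒∣∣m-n∣ {d} {m} {n} d∣m d∣n with ≤-total n m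
  ... | inj₁ n≤m = subst (d ∣_) (sym (m≤n⇒∣n-m∣≡n∸m n≤m)) (∣m+n∣m⇒∣n (subst (d ∣_) (sym (m+[n∸m]≡n n≤m)) d∣m) d∣n)
  ... | inj₂ m≤n = subst (d ∣_) (sym (m≤n⇒∣m-n∣≡n∸m m≤n)) (∣m+n∣m⇒∣n (subst (d ∣_) (sym (m+[n∸m]≡n m≤n)) d∣n) d∣m)

  common-divisor∣cross : ∀ a ℓ c μ m {g} → g ∣ lin⁺ a ℓ m → g ∣ lin⁺ c μ m → g ∣ ∣ a * μ - c * ℓ ∣
  common-divisor∣cross a ℓ c μ m {g} g∣L g∣H = subst (g ∣_) (∣m+n-m+o∣≡∣n-o∣ (a * c * m) (a * μ) (c * ℓ))
    (∣m∣n⇒∣∣m-n∣ (subst (g ∣_) (expandH a c μ m) (∣n⇒∣m*n a g∣H)) (subst (g ∣_) (expandL a c ℓ m) (∣n⇒∣m*n c g∣L)))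
    where
    expandH : ∀ a c μ m → a * (c * m + μ) ≡ a * c * m + a * μ
    expandH = solve-∀
    expandL : ∀ a c ℓ m → c * (a * m + ℓ) ≡ a * c * m + c * ℓ
    expandL = solve-∀


module AbundantProgressions where

  open import Data.Nat
  open import Data.Nat.Properties
  open import Data.Nat.DivMod using (_%_; _/_; m≡m%n+[m/n]*n; m%n<n)
  open import Data.Nat.Divisibility using (_∣_; ∣-trans; ∣1⇒≡1; ∣m+n∣m⇒∣n; ∣m∣n⇒∣m+n; ∣m⇒∣m*n; ∣n⇒∣m*n; m∣m*n; n∣m*n)
  open import Data.Nat.Coprimality using (Coprime; coprime-divisor)
  open import Data.Nat.Tactic.RingSolver using (solve-∀)
  open import Data.Fin using (Fin; zero; suc)
  open import Data.Product using (_,_; proj₁; proj₂)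
  open import Relation.Binary.PropositionalEquality
  open import Defs using (σ)
  open AbundantModuli using (abundant-modulus)
  open NaturalLinearForms using (lin⁺)

  coprime-* : ∀ {m P A} → Coprime m P → Coprime m A → Coprime m (P * A)
  coprime-* m⊥P m⊥A (d∣m , d∣PA) = m⊥A (d∣m , coprime-divisor (λ (i∣d , i∣P) → m⊥P (∣-trans i∣d d∣m , i∣P)) d∣PA)

  -- Modulo A = 1 + c u the number -u inverts c, so z = u η mod A solves η + c z ≡ 0.
  ∣η+c*[u*η%A] : ∀ {A} c u η .{{_ : NonZero A}} → A ≡ 1 + c * u → A ∣ η + c * ((u * η) % A)
  ∣η+c*[u*η%A] {A} c u η A≡1+cu = ∣m+n∣m⇒∣n (subst (A ∣_) ηA≡ (n∣m*n η)) (m∣m*n (c * q))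
    where
    z = (u * η) % A
    q = (u * η) / A
    ηA≡ : η * A ≡ A * (c * q) + (η + c * z)
    ηA≡ = begin
      η * A                      ≡⟨ cong (η *_) A≡1+cu ⟩
      η * (1 + c * u)            ≡⟨ expand η c u ⟩
      η + c * (u * η)            ≡⟨ cong (λ x → η + c * x) (m≡m%n+[m/n]*n (u * η) A) ⟩
      η + c * (z + q * A)        ≡⟨ regroup η c z q A ⟩
      A * (c * q) + (η + c * z)  ∎
      where
      open ≡-Reasoning
      expand : ∀ η c u → η * (1 + c * u) ≡ η + c * (u * η)
      expand = solve-∀
      regroup : ∀ η c z q A → η + c * (z + q * A) ≡ A * (c * q) + (η + c * z)
      regroup = solve-∀

  ∣lin⁺-shifted : ∀ c μ w P v {A} .{{_ : NonZero A}} → A ≡ 1 + c * P * v → ∀ t →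
                  A ∣ lin⁺ c μ (w + P * ((v * lin⁺ c μ w) % A) + P * A * t)
  ∣lin⁺-shifted c μ w P v {A} A≡1+cPv t = subst (A ∣_) (sym (regroup c μ w P z A t))
    (∣m∣n⇒∣m+n (∣η+c*[u*η%A] (c * P) v η A≡1+cPv) (m∣m*n (c * P * t)))
    where
    η = lin⁺ c μ w
    z = (v * η) % A
    regroup : ∀ c μ w P z A t → c * (w + P * z + P * A * t) + μ ≡ (c * w + μ) + c * P * z + A * (c * P * t)
    regroup = solve-∀

  module _ {k} (a ℓ : Fin k → ℕ) (B K : ℕ) (1≤B : 1 ≤ B) where

    L : Fin k → ℕ → ℕ
    L i = lin⁺ (a i) (ℓ i)

    record AbundantProgression {n} (c μ : Fin n → ℕ) : Set where
      field
        P w      : ℕ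
        1≤P      : 1 ≤ P
        w<P      : w < P
        abundant : ∀ j t → K * lin⁺ (c j) (μ j) (w + P * t) ≤ σ (lin⁺ (c j) (μ j) (w + P * t))
        coprime  : ∀ i t → Coprime (L i (w + P * t)) P

    -- The new modulus is A ≡ 1 (mod c₀ P B): the factor c₀ P lets H₀ reach a multiple of A inside
    -- the old progression, and the factor B keeps A coprime to every L_i there.
    extend : ∀ {n} (c μ : Fin (suc n) → ℕ) → 1 ≤ c zero → 1 ≤ μ zero →
             (∀ i m {g} → g ∣ L i m → g ∣ lin⁺ (c zero) (μ zero) m → g ∣ B) →
             AbundantProgression (λ j → c (suc j)) (λ j → μ (suc j)) → AbundantProgression c μ
    extend c μ 1≤c₀ 1≤μ₀ gcd∣B prog = record
      { P = P * A ; w = w′ ; 1≤P = *-mono-≤ 1≤P 1≤A ; w<P = w′<PA ; abundant = abundant′ ; coprime = coprime′ }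
      where
      open AbundantProgression prog
      c₀ = c zero
      μ₀ = μ zero
      base = c₀ * P * B
      modulus = abundant-modulus base K (*-mono-≤ (*-mono-≤ 1≤c₀ 1≤P) 1≤B)
      u = proj₁ modulus
      A = 1 + base * u
      1≤A : 1 ≤ A
      1≤A = s≤s z≤n
      η = lin⁺ c₀ μ₀ w
      z = (B * u * η) % A
      w′ = w + P * z
      w′<PA : w′ < P * A
      w′<PA = begin-strict
        w + P * z  <⟨ +-monoˡ-< (P * z) w<P ⟩
        P + P * z  ≡⟨ *-suc P z ⟨
        P * suc z  ≤⟨ *-monoʳ-≤ P (m%n<n (B * u * η) A) ⟩
        P * A      ∎
        where open ≤-Reasoning
      shift : ∀ t → w′ + P * A * t ≡ w + P * (z + A * t)
      shift t = regroup w P z A t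
        where
        regroup : ∀ w P z A t → w + P * z + P * A * t ≡ w + P * (z + A * t)
        regroup = solve-∀
      A∣H₀ : ∀ t → A ∣ lin⁺ c₀ μ₀ (w′ + P * A * t)
      A∣H₀ = ∣lin⁺-shifted c₀ μ₀ w P (B * u) (cong suc (reassoc c₀ P B u))
        where
        reassoc : ∀ c P B u → c * P * B * u ≡ c * P * (B * u)
        reassoc = solve-∀
      abundant′ : ∀ j t → K * lin⁺ (c j) (μ j) (w′ + P * A * t) ≤ σ (lin⁺ (c j) (μ j) (w′ + P * A * t))
      abundant′ zero    t = proj₂ modulus _ {{>-nonZero (≤-trans 1≤μ₀ (m≤n+m μ₀ _))}} (A∣H₀ t)
      abundant′ (suc j) t = subst (λ m → K * lin⁺ (c (suc j)) (μ (suc j)) m ≤ σ (lin⁺ (c (suc j)) (μ (suc j)) m))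
                                  (sym (shift t)) (abundant j (z + A * t))
      coprime′ : ∀ i t → Coprime (L i (w′ + P * A * t)) (P * A)
      coprime′ i t = coprime-* (subst (λ m → Coprime (L i m) P) (sym (shift t)) (coprime i (z + A * t))) coprime-A
        where
        coprime-A : Coprime (L i (w′ + P * A * t)) A
        coprime-A {g} (g∣L , g∣A) =
          ∣1⇒≡1 (∣m+n∣m⇒∣n (subst (g ∣_) (+-comm 1 (base * u)) g∣A) (∣m⇒∣m*n u (∣n⇒∣m*n (c₀ * P) g∣B)))
          where
          g∣B = gcd∣B i (w′ + P * A * t) g∣L (∣-trans g∣A (A∣H₀ t))

    abundant-progression : ∀ {n} (c μ : Fin n → ℕ) → (∀ j → 1 ≤ c j) → (∀ j → 1 ≤ μ j) →
                           (∀ i j m {g} → g ∣ L i m → g ∣ lin⁺ (c j) (μ j) m → g ∣ B) → AbundantProgression c μ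
    abundant-progression {zero}  c μ _   _   _     = record
      { P = 1 ; w = 0 ; 1≤P = ≤-refl ; w<P = s≤s z≤n ; abundant = λ () ; coprime = λ i t (_ , d∣1) → ∣1⇒≡1 d∣1 }
    abundant-progression {suc n} c μ c≥1 μ≥1 gcd∣B =
      extend c μ (c≥1 zero) (μ≥1 zero) (λ i → gcd∣B i zero)
        (abundant-progression (λ j → c (suc j)) (λ j → μ (suc j)) (λ j → c≥1 (suc j)) (λ j → μ≥1 (suc j)) (λ i j → gcd∣B i (suc j)))


module IntegerLinearForms where

  open import Data.Nat as ℕ using (ℕ; _≤_; _<_; s≤s; z≤n)
  import Data.Nat.Properties as ℕ
  open import Data.Integer as ℤ using (ℤ; +_; -[1+_]; ∣_∣; 0ℤ; _⊖_)
  import Data.Integer.Properties as ℤ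
  open import Data.Integer.Tactic.RingSolver using (solve-∀)
  open import Relation.Binary.PropositionalEquality
  open import Defs using (lin)
  open NaturalLinearForms using (lin⁺)

  +∣i∣≡i : ∀ {i} → 0ℤ ℤ.< i → + ∣ i ∣ ≡ i
  +∣i∣≡i 0<i = ℤ.0≤i⇒+∣i∣≡i (ℤ.<⇒≤ 0<i)

  1≤∣i∣ : ∀ {i} → 0ℤ ℤ.< i → 1 ≤ ∣ i ∣
  1≤∣i∣ 0<i = ℤ.drop‿+<+ (subst (0ℤ ℤ.<_) (sym (+∣i∣≡i 0<i)) 0<i)

  lin-positive : ∀ {a} b r → 0ℤ ℤ.< a → ∣ b ∣ < r → 0ℤ ℤ.< lin a b (+ r)
  lin-positive {a} b r 0<a ∣b∣<r = subst (λ a → 0ℤ ℤ.< lin a b (+ r)) (+∣i∣≡i 0<a) (positive b ∣b∣<r)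
    where
    r≤∣a∣r : r ≤ ∣ a ∣ ℕ.* r
    r≤∣a∣r = ℕ.≤-trans (ℕ.≤-reflexive (sym (ℕ.*-identityˡ r))) (ℕ.*-monoˡ-≤ r (1≤∣i∣ 0<a))
    positive : ∀ b → ∣ b ∣ < r → 0ℤ ℤ.< lin (+ ∣ a ∣) b (+ r)
    positive (+ n) n<r = subst (0ℤ ℤ.<_) (cong (ℤ._+ + n) (ℤ.pos-* ∣ a ∣ r))
      (ℤ.+<+ (ℕ.≤-trans (ℕ.≤-trans (ℕ.≤-trans (s≤s z≤n) n<r) r≤∣a∣r) (ℕ.m≤m+n _ n)))
    positive -[1+ n ] n<r = subst (0ℤ ℤ.<_) (trans (sym (ℤ.⊖-≥ (ℕ.<⇒≤ 1+n<∣a∣r))) (cong (ℤ._+ -[1+ n ]) (ℤ.pos-* ∣ a ∣ r)))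
      (ℤ.+<+ (ℕ.m<n⇒0<n∸m 1+n<∣a∣r))
      where
      1+n<∣a∣r : ℕ.suc n < ∣ a ∣ ℕ.* r
      1+n<∣a∣r = ℕ.<-≤-trans n<r r≤∣a∣r

  lin-shift : ∀ {a b} r m → 0ℤ ℤ.< a → 0ℤ ℤ.< lin a b (+ r) → lin a b (+ (r ℕ.+ m)) ≡ + lin⁺ ∣ a ∣ ∣ lin a b (+ r) ∣ m
  lin-shift {a} {b} r m 0<a 0<L = begin
    a ℤ.* + (r ℕ.+ m) ℤ.+ b                      ≡⟨ cong (λ x → a ℤ.* x ℤ.+ b) (ℤ.pos-+ r m) ⟩
    a ℤ.* (+ r ℤ.+ + m) ℤ.+ b                    ≡⟨ regroup a b (+ r) (+ m) ⟩
    a ℤ.* + m ℤ.+ lin a b (+ r)                  ≡⟨ cong₂ (λ x y → x ℤ.* + m ℤ.+ y) (+∣i∣≡i 0<a) (+∣i∣≡i 0<L) ⟨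
    + ∣ a ∣ ℤ.* + m ℤ.+ + ∣ lin a b (+ r) ∣      ≡⟨ cong (ℤ._+ + ∣ lin a b (+ r) ∣) (ℤ.pos-* ∣ a ∣ m) ⟨
    + (∣ a ∣ ℕ.* m) ℤ.+ + ∣ lin a b (+ r) ∣      ≡⟨ ℤ.pos-+ (∣ a ∣ ℕ.* m) _ ⟨
    + lin⁺ ∣ a ∣ ∣ lin a b (+ r) ∣ m             ∎
    where
    open ≡-Reasoning
    regroup : ∀ a b r m → a ℤ.* (r ℤ.+ m) ℤ.+ b ≡ a ℤ.* m ℤ.+ (a ℤ.* r ℤ.+ b)
    regroup = solve-∀

  lin-cross : ∀ a b c d x → a ℤ.* lin c d x ≡ c ℤ.* lin a b x → a ℤ.* d ≡ b ℤ.* c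
  lin-cross a b c d x aH≡cL = begin
    a ℤ.* d                                     ≡⟨ isolate a c d x ⟩
    a ℤ.* lin c d x ℤ.- c ℤ.* (a ℤ.* x)         ≡⟨ cong (ℤ._- c ℤ.* (a ℤ.* x)) aH≡cL ⟩
    c ℤ.* lin a b x ℤ.- c ℤ.* (a ℤ.* x)         ≡⟨ cancel a b c x ⟩
    b ℤ.* c                                     ∎
    where
    open ≡-Reasoning
    isolate : ∀ a c d x → a ℤ.* d ≡ a ℤ.* (c ℤ.* x ℤ.+ d) ℤ.- c ℤ.* (a ℤ.* x)
    isolate = solve-∀
    cancel : ∀ a b c x → c ℤ.* (a ℤ.* x ℤ.+ b) ℤ.- c ℤ.* (a ℤ.* x) ≡ b ℤ.* c
    cancel = solve-∀


module Windows where

  open import Data.Nat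
  open import Data.Nat.Properties
  open import Data.Nat.DivMod using (_/_; m<n*o⇒m/o<n)
  open import Data.Nat.Coprimality using (Coprime)
  open import Data.Nat.Tactic.RingSolver using (solve-∀)
  open import Data.Fin using (Fin; fromℕ<)
  open import Relation.Nullary using (Dec; ¬_)
  open import Relation.Binary.PropositionalEquality
  open import Defs using (σ)
  open FiniteSums
  open FinSums
  open NaturalLinearForms using (lin⁺)
  open DivisorSumsInProgressions using (∑σ-progression≤)

  module _ {k} (1≤k : 1 ≤ k) (a ℓ c μ : Fin k → ℕ) (1≤a : ∀ i → 1 ≤ a i) (1≤c : ∀ j → 1 ≤ c j) where

    Σa Σℓ : ℕ
    Σa = sumFin a
    Σℓ = sumFin ℓ

    1≤Σa : 1 ≤ Σa
    1≤Σa = ≤-trans (1≤a (fromℕ< 1≤k)) (sumFin-≥ a (fromℕ< 1≤k))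

    K : ℕ
    K = 14 * k * Σa * (Σℓ + 3 * Σa)

    module InProgression (P w : ℕ) (1≤P : 1 ≤ P) (w<P : w < P)
             (abundant : ∀ j t → K * lin⁺ (c j) (μ j) (w + P * t) ≤ σ (lin⁺ (c j) (μ j) (w + P * t)))
             (coprime : ∀ i t → Coprime (lin⁺ (a i) (ℓ i) (w + P * t)) P)
             {q} {Q : ℕ → Set q} (Q? : ∀ t → Dec (Q t))
             (sufficient : ∀ t → (∀ j → sumFin (λ i → σ (lin⁺ (a i) (ℓ i) (w + P * t))) < σ (lin⁺ (c j) (μ j) (w + P * t))) → Q t)
             where

      F : ℕ → ℕ
      F t = sumFin (λ i → σ (lin⁺ (a i) (ℓ i) (w + P * t)))

      Λ s : ℕ
      Λ = Σℓ + Σa * P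
      s = Λ + 2 * Σa * P

      α : Fin k → ℕ
      α i = a i * w + ℓ i

      α≤Λ : ∀ i → α i ≤ Λ
      α≤Λ i = ≤-trans (+-mono-≤ (*-mono-≤ (sumFin-≥ a i) (<⇒≤ w<P)) (sumFin-≥ ℓ i)) (≤-reflexive (+-comm (Σa * P) Σℓ))

      L≡α+aPt : ∀ i t → lin⁺ (a i) (ℓ i) (w + P * t) ≡ α i + a i * P * t
      L≡α+aPt i t = regroup (a i) (ℓ i) w P t
        where
        regroup : ∀ a ℓ w P t → a * (w + P * t) + ℓ ≡ a * w + ℓ + a * P * t
        regroup = solve-∀

      -- By Markov's inequality at most T / 2 of the t < 2 T have F t ≥ Y; every other t ≥ T is good,
      -- since then F t < Y ≤ K P T ≤ K H_j(w + P t) ≤ σ (H_j(w + P t)).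
      module _ (T : ℕ) (1+s≤T : suc s ≤ T) where

        1≤T : 1 ≤ T
        1≤T = ≤-trans (s≤s z≤n) 1+s≤T

        X Y : ℕ
        X = Λ + Σa * P * (2 * T)
        Y = 14 * k * Σa * X

        X≤sT : X ≤ s * T
        X≤sT = begin
          Λ + Σa * P * (2 * T)       ≤⟨ +-monoˡ-≤ _ (m≤m*n Λ T {{>-nonZero 1≤T}}) ⟩
          Λ * T + Σa * P * (2 * T)   ≡⟨ collect Λ Σa P T ⟩
          s * T                      ∎
          where
          open ≤-Reasoning
          collect : ∀ Λ A P T → Λ * T + A * P * (2 * T) ≡ (Λ + 2 * A * P) * T
          collect = solve-∀

        X/[1+s]≤T : X / suc s ≤ T
        X/[1+s]≤T = <⇒≤ (m<n*o⇒m/o<n (begin-strict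
          X          ≤⟨ X≤sT ⟩
          s * T      <⟨ m<m+n (s * T) 1≤T ⟩
          s * T + T  ≡⟨ +-comm (s * T) T ⟩
          suc s * T  ≡⟨ *-comm (suc s) T ⟩
          T * suc s  ∎))
          where open ≤-Reasoning

        ∑σL≤ : ∀ i → ∑[ t < 2 * T ] σ (lin⁺ (a i) (ℓ i) (w + P * t)) ≤ X * (7 * Σa * T)
        ∑σL≤ i = begin
          ∑[ t < 2 * T ] σ (lin⁺ (a i) (ℓ i) (w + P * t))  ≡⟨ ∑-cong (2 * T) (λ t _ → cong σ (L≡α+aPt i t)) ⟩
          ∑[ t < 2 * T ] σ (α i + a i * P * t)              ≤⟨ ∑σ-progression≤ (α i) (a i) P (1≤a i) coprime′ (2 * T) X s α+aP2T≤X ⟩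
          X * (2 * (a i * (2 * T)) + s + X / suc s + 1)     ≤⟨ *-monoʳ-≤ X factor≤ ⟩
          X * (7 * Σa * T)                                  ∎
          where
          open ≤-Reasoning
          coprime′ : ∀ t → Coprime (α i + a i * P * t) P
          coprime′ t = subst (λ m → Coprime m P) (L≡α+aPt i t) (coprime i t)
          α+aP2T≤X : α i + a i * P * (2 * T) ≤ X
          α+aP2T≤X = +-mono-≤ (α≤Λ i) (*-monoˡ-≤ (2 * T) (*-monoˡ-≤ P (sumFin-≥ a i)))
          factor≤ : 2 * (a i * (2 * T)) + s + X / suc s + 1 ≤ 7 * Σa * T
          factor≤ = begin
            2 * (a i * (2 * T)) + s + X / suc s + 1  ≤⟨ +-mono-≤ (+-mono-≤ (+-mono-≤ (*-monoʳ-≤ 2 (*-monoˡ-≤ (2 * T) (sumFin-≥ a i)))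
                                                                                    (≤-trans (n≤1+n s) 1+s≤T))
                                                                         X/[1+s]≤T) 1≤T ⟩
            2 * (Σa * (2 * T)) + T + T + T           ≡⟨ collect-T (2 * (Σa * (2 * T))) T ⟩
            2 * (Σa * (2 * T)) + 3 * T               ≤⟨ +-monoʳ-≤ (2 * (Σa * (2 * T))) (*-monoʳ-≤ 3 T≤ΣaT) ⟩
            2 * (Σa * (2 * T)) + 3 * (Σa * T)        ≡⟨ collect Σa T ⟩
            7 * Σa * T                               ∎
            where
            T≤ΣaT : T ≤ Σa * T
            T≤ΣaT = ≤-trans (≤-reflexive (sym (*-identityˡ T))) (*-monoˡ-≤ T 1≤Σa)
            collect-T : ∀ Z T → Z + T + T + T ≡ Z + 3 * T
            collect-T = solve-∀
            collect : ∀ A T → 2 * (A * (2 * T)) + 3 * (A * T) ≡ 7 * A * T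
            collect = solve-∀

        ∑F≤ : ∑ (2 * T) F ≤ k * (X * (7 * Σa * T))
        ∑F≤ = begin
          ∑ (2 * T) F                                                   ≡⟨ ∑-sumFin (2 * T) (λ i t → σ (lin⁺ (a i) (ℓ i) (w + P * t))) ⟩
          sumFin (λ i → ∑[ t < 2 * T ] σ (lin⁺ (a i) (ℓ i) (w + P * t))) ≤⟨ sumFin-mono-≤ ∑σL≤ ⟩
          sumFin {k} (λ _ → X * (7 * Σa * T))                           ≡⟨ sumFin-const k _ ⟩
          k * (X * (7 * Σa * T))                                        ∎
          where open ≤-Reasoning

        large? : ∀ t → Dec (Y ≤ F t)
        large? t = Y ≤? F t

        few-large : 2 * count< large? (2 * T) ≤ T
        few-large = *-cancelʳ-≤ _ T (7 * k * Σa * X) {{7kΣaX≢0}} (begin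
          2 * count< large? (2 * T) * (7 * k * Σa * X) ≡⟨ regroup (count< large? (2 * T)) k Σa X ⟩
          count< large? (2 * T) * Y                    ≤⟨ markov F Y (2 * T) ⟩
          ∑ (2 * T) F                                  ≤⟨ ∑F≤ ⟩
          k * (X * (7 * Σa * T))                       ≡⟨ regroup′ k X Σa T ⟩
          T * (7 * k * Σa * X)                         ∎)
          where
          open ≤-Reasoning
          1≤X : 1 ≤ X
          1≤X = ≤-trans (*-mono-≤ (*-mono-≤ 1≤Σa 1≤P) (*-mono-≤ {1} {2} (s≤s z≤n) 1≤T)) (m≤n+m _ Λ)
          7kΣaX≢0 : NonZero (7 * k * Σa * X)
          7kΣaX≢0 = >-nonZero (*-mono-≤ (*-mono-≤ (*-mono-≤ {1} {7} (s≤s z≤n) 1≤k) 1≤Σa) 1≤X)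
          regroup : ∀ n k A X → 2 * n * (7 * k * A * X) ≡ n * (14 * k * A * X)
          regroup = solve-∀
          regroup′ : ∀ k X A T → k * (X * (7 * A * T)) ≡ T * (7 * k * A * X)
          regroup′ = solve-∀

        Y≤KPT : Y ≤ K * (P * T)
        Y≤KPT = begin
          14 * k * Σa * X                           ≤⟨ *-monoʳ-≤ (14 * k * Σa) X≤ ⟩
          14 * k * Σa * ((Σℓ + 3 * Σa) * (P * T))   ≡⟨ *-assoc (14 * k * Σa) (Σℓ + 3 * Σa) (P * T) ⟨
          K * (P * T)                               ∎
          where
          open ≤-Reasoning
          X≤ : X ≤ (Σℓ + 3 * Σa) * (P * T)
          X≤ = begin
            Σℓ + Σa * P + Σa * P * (2 * T)                   ≤⟨ +-monoˡ-≤ _ (+-mono-≤ (m≤m*n Σℓ (P * T) {{>-nonZero (*-mono-≤ 1≤P 1≤T)}})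
                                                                                     (m≤m*n (Σa * P) T {{>-nonZero 1≤T}})) ⟩
            Σℓ * (P * T) + Σa * P * T + Σa * P * (2 * T)     ≡⟨ collect Σℓ Σa P T ⟩
            (Σℓ + 3 * Σa) * (P * T)                          ∎
            where
            collect : ∀ L A P T → L * (P * T) + A * P * T + A * P * (2 * T) ≡ (L + 3 * A) * (P * T)
            collect = solve-∀

        small⇒Q : ∀ t → T ≤ t → ¬ (Y ≤ F t) → Q t
        small⇒Q t T≤t small = sufficient t λ j → begin-strict
          F t                                    <⟨ ≰⇒> small ⟩
          Y                                      ≤⟨ Y≤KPT ⟩
          K * (P * T)                            ≤⟨ *-monoʳ-≤ K (PT≤H j) ⟩
          K * lin⁺ (c j) (μ j) (w + P * t)       ≤⟨ abundant j t ⟩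
          σ (lin⁺ (c j) (μ j) (w + P * t))       ∎
          where
          open ≤-Reasoning
          PT≤H : ∀ j → P * T ≤ lin⁺ (c j) (μ j) (w + P * t)
          PT≤H j = begin
            P * T                      ≤⟨ *-monoʳ-≤ P T≤t ⟩
            P * t                      ≤⟨ m≤n+m (P * t) w ⟩
            w + P * t                  ≤⟨ m≤n*m (w + P * t) (c j) {{>-nonZero (1≤c j)}} ⟩
            c j * (w + P * t)          ≤⟨ m≤m+n _ (μ j) ⟩
            c j * (w + P * t) + μ j    ∎

        window : T ≤ 2 * count< Q? (2 * T)
        window = +-cancelʳ-≤ T T (2 * count< Q? (2 * T)) (begin
          T + T                                                ≡⟨ T+T≡2T ⟩
          2 * T                                                ≤⟨ *-monoʳ-≤ 2 covered ⟩
          2 * (count< Q? (2 * T) + count< large? (2 * T))      ≡⟨ *-distribˡ-+ 2 (count< Q? (2 * T)) _ ⟩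
          2 * count< Q? (2 * T) + 2 * count< large? (2 * T)    ≤⟨ +-monoʳ-≤ (2 * count< Q? (2 * T)) few-large ⟩
          2 * count< Q? (2 * T) + T                            ∎)
          where
          open ≤-Reasoning
          T+T≡2T : T + T ≡ 2 * T
          T+T≡2T = cong (T +_) (sym (+-identityʳ T))
          in-second-half : ∀ {f} → ∑[ t < T ] f (T + t) ≤ ∑ (2 * T) f
          in-second-half {f} = subst (λ n → ∑[ t < T ] f (T + t) ≤ ∑ n f) T+T≡2T (∑-shift-≤ f T T)
          covered : T ≤ count< Q? (2 * T) + count< large? (2 * T)
          covered = ≤-trans (count<-cover (λ t → large? (T + t)) (λ t → Q? (T + t)) T (λ t _ → small⇒Q (T + t) (m≤m+n T t)))
                            (+-mono-≤ in-second-half in-second-half)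


module Density where

  open import Data.Nat
  open import Data.Nat.Properties
  open import Data.Nat.DivMod using (_/_; m/n*n≤m)
  open import Data.Nat.Tactic.RingSolver using (solve-∀)
  open import Relation.Nullary using (Dec)
  open import Relation.Binary.PropositionalEquality
  open FiniteSums
  open QuotientSums using (m<[1+m/n]*n; m*n≤o⇒m≤o/n)

  density-from-windows : ∀ {q} {Q : ℕ → Set q} (Q? : ∀ n → Dec (Q n)) r P T₀ → 1 ≤ P →
                         (∀ T → T₀ ≤ T → T ≤ 2 * count< (λ t → Q? (r + P * t)) (2 * T)) →
                         ∀ x → 4 * P * suc T₀ + 2 * r ≤ x → x ≤ 16 * P * count< Q? x
  density-from-windows Q? r P T₀ 1≤P window x x₀≤x = begin
    x                                    ≤⟨ <⇒≤ (m<[1+m/n]*n x (4 * P)) ⟩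
    suc T * (4 * P)                      ≤⟨ *-monoˡ-≤ (4 * P) (+-monoˡ-≤ T 1≤T) ⟩
    (T + T) * (4 * P)                    ≤⟨ *-monoˡ-≤ (4 * P) (+-mono-≤ T≤2G T≤2G) ⟩
    (2 * G + 2 * G) * (4 * P)            ≡⟨ collect G P ⟩
    16 * P * G                           ≤⟨ *-monoʳ-≤ (16 * P) (∑-progression-≤ (λ n → 𝟙 (Q? n)) r P (2 * T) x 1≤P fits) ⟩
    16 * P * count< Q? x                 ∎
    where
    open ≤-Reasoning
    instance
      4P≢0 : NonZero (4 * P)
      4P≢0 = m*n≢0 4 P {{_}} {{>-nonZero 1≤P}}
    T = x / (4 * P)
    G = count< (λ t → Q? (r + P * t)) (2 * T)
    1+T₀≤T : suc T₀ ≤ T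
    1+T₀≤T = m*n≤o⇒m≤o/n (suc T₀) (4 * P) x (≤-trans (≤-reflexive (*-comm (suc T₀) (4 * P))) (≤-trans (m≤m+n _ _) x₀≤x))
    1≤T : 1 ≤ T
    1≤T = ≤-trans (s≤s z≤n) 1+T₀≤T
    T≤2G : T ≤ 2 * G
    T≤2G = window T (<⇒≤ 1+T₀≤T)
    fits : r + P * (2 * T) ≤ x
    fits = *-cancelˡ-≤ 2 (begin
      2 * (r + P * (2 * T))   ≡⟨ expand r P T ⟩
      2 * r + T * (4 * P)     ≤⟨ +-mono-≤ (≤-trans (m≤n+m (2 * r) (4 * P * suc T₀)) x₀≤x) (m/n*n≤m x (4 * P)) ⟩
      x + x                   ≡⟨ cong (x +_) (+-identityʳ x) ⟨
      2 * x                   ∎)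
      where
      expand : ∀ r P T → 2 * (r + P * (2 * T)) ≡ 2 * r + T * (4 * P)
      expand = solve-∀
    collect : ∀ G P → (2 * G + 2 * G) * (4 * P) ≡ 16 * P * G
    collect = solve-∀


open import Defs
open import Data.Nat using (ℕ; _≤_; _*_; _^_; NonZero; _+_; >-nonZero)
open import Data.Nat.Properties using (≤-trans; m≤m+n; m≤n+m; m≤m*n; m^n≢0)
open import Data.Nat.Primality using (Prime)
open import Data.Nat.Logarithm using (⌊log₂_⌋; ⌊log₂⌋-mono-≤)
open import Data.Integer as ℤ using (ℤ; +_)
open import Data.Fin using (Fin)
open import Data.Product using (Σ; ∃; _×_; _,_)
open import Relation.Nullary using (¬_)
open import Relation.Binary.PropositionalEquality using (_≢_)


module PositiveDensity {k} (1≤k : 1 ≤ k) (a b c d : Fin k → ℤ)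
                       (0<a : ∀ i → ℤ.0ℤ ℤ.< a i) (0<c : ∀ j → ℤ.0ℤ ℤ.< c j)
                       (ad≢bc : ∀ i j → a i ℤ.* d j ≢ b i ℤ.* c j) where

  open import Data.Nat using (suc; _<_; ∣_-_∣; s≤s; _!)
  open import Data.Nat.Properties
  open import Data.Nat.Divisibility using (_∣_; ∣-trans; m∣m*n; m≤n⇒m!∣n!)
  open import Data.Integer using (∣_∣)
  import Data.Integer.Properties as ℤ
  open import Data.List using (map; filter; length; upTo)
  open import Data.List.Properties using (map-∘)
  open import Data.Nat.ListAction using (sum)
  open import Function using (_∘_)
  open import Relation.Nullary using (Dec)
  open import Relation.Binary.PropositionalEquality
  open FiniteSums
  open FinSums
  open NaturalLinearForms
  open IntegerLinearForms
  open AbundantProgressions using (AbundantProgression; abundant-progression; module AbundantProgression)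
  open Density using (density-from-windows)
  open Windows using (module InProgression)

  -- From r₀ on all the forms are positive, and n = r₀ + m turns them into forms over ℕ.
  r₁ r₀ : ℕ
  r₁ = sumFin (λ i → ∣ b i ∣ + ∣ d i ∣)
  r₀ = suc r₁

  0<L : ∀ i → ℤ.0ℤ ℤ.< lin (a i) (b i) (+ r₀)
  0<L i = lin-positive (b i) r₀ (0<a i) (s≤s (≤-trans (m≤m+n _ _) (sumFin-≥ (λ i → ∣ b i ∣ + ∣ d i ∣) i)))

  0<H : ∀ j → ℤ.0ℤ ℤ.< lin (c j) (d j) (+ r₀)
  0<H j = lin-positive (d j) r₀ (0<c j) (s≤s (≤-trans (m≤n+m _ _) (sumFin-≥ (λ i → ∣ b i ∣ + ∣ d i ∣) j)))

  a′ ℓ c′ μ : Fin k → ℕ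
  a′ i = ∣ a i ∣
  ℓ  i = ∣ lin (a i) (b i) (+ r₀) ∣
  c′ j = ∣ c j ∣
  μ  j = ∣ lin (c j) (d j) (+ r₀) ∣

  1≤a′ : ∀ i → 1 ≤ a′ i
  1≤a′ i = 1≤∣i∣ (0<a i)

  1≤ℓ : ∀ i → 1 ≤ ℓ i
  1≤ℓ i = 1≤∣i∣ (0<L i)

  1≤c′ : ∀ j → 1 ≤ c′ j
  1≤c′ j = 1≤∣i∣ (0<c j)

  1≤μ : ∀ j → 1 ≤ μ j
  1≤μ j = 1≤∣i∣ (0<H j)

  L-shift : ∀ i m → lin (a i) (b i) (+ (r₀ + m)) ≡ + lin⁺ (a′ i) (ℓ i) m
  L-shift i m = lin-shift r₀ m (0<a i) (0<L i)

  H-shift : ∀ j m → lin (c j) (d j) (+ (r₀ + m)) ≡ + lin⁺ (c′ j) (μ j) m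
  H-shift j m = lin-shift r₀ m (0<c j) (0<H j)

  D : Fin k → Fin k → ℕ
  D i j = ∣ a′ i * μ j - c′ j * ℓ i ∣

  1≤D : ∀ i j → 1 ≤ D i j
  1≤D i j = n≢0⇒n>0 (λ D≡0 → ad≢bc i j (lin-cross (a i) (b i) (c j) (d j) (+ r₀) (begin
    a i ℤ.* lin (c j) (d j) (+ r₀)   ≡⟨ cong₂ ℤ._*_ (+∣i∣≡i (0<a i)) (+∣i∣≡i (0<H j)) ⟨
    + a′ i ℤ.* + μ j                 ≡⟨ ℤ.pos-* (a′ i) (μ j) ⟨
    + (a′ i * μ j)                   ≡⟨ cong +_ (∣m-n∣≡0⇒m≡n D≡0) ⟩
    + (c′ j * ℓ i)                   ≡⟨ ℤ.pos-* (c′ j) (ℓ i) ⟩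
    + c′ j ℤ.* + ℓ i                 ≡⟨ cong₂ ℤ._*_ (+∣i∣≡i (0<c j)) (+∣i∣≡i (0<L i)) ⟩
    c j ℤ.* lin (a i) (b i) (+ r₀)   ∎)))
    where open ≡-Reasoning

  -- A common multiple of all the D i j.
  B : ℕ
  B = sumFin (λ j → sumFin (λ i → D i j)) !

  1≤B : 1 ≤ B
  1≤B = 1≤n! (sumFin (λ j → sumFin (λ i → D i j)))

  common-divisor∣B : ∀ i j m {g} → g ∣ lin⁺ (a′ i) (ℓ i) m → g ∣ lin⁺ (c′ j) (μ j) m → g ∣ B
  common-divisor∣B i j m g∣L g∣H = ∣-trans (common-divisor∣cross (a′ i) (ℓ i) (c′ j) (μ j) m g∣L g∣H) D∣B
    where
    D≤ : D i j ≤ sumFin (λ j → sumFin (λ i → D i j))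
    D≤ = ≤-trans (sumFin-≥ (λ i → D i j) i) (sumFin-≥ (λ j → sumFin (λ i → D i j)) j)
    ∣! : ∀ {x n} → 1 ≤ x → x ≤ n → x ∣ n !
    ∣! {suc x} _ 1+x≤n = ∣-trans (m∣m*n (x !)) (m≤n⇒m!∣n! 1+x≤n)
    D∣B : D i j ∣ B
    D∣B = ∣! (1≤D i j) D≤

  K : ℕ
  K = Windows.K 1≤k a′ ℓ c′ μ 1≤a′ 1≤c′

  progression : AbundantProgression a′ ℓ B K 1≤B c′ μ
  progression = abundant-progression a′ ℓ B K 1≤B c′ μ 1≤c′ 1≤μ common-divisor∣B

  open AbundantProgression progression

  good-shifted : ∀ m → (∀ j → sumFin (λ i → σ (lin⁺ (a′ i) (ℓ i) m)) < σ (lin⁺ (c′ j) (μ j) m)) → Good a b c d (r₀ + m)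
  good-shifted m σL<σH = 0<L[r₀+m] , 0<H[r₀+m] , σL<σH′
    where
    0<L[r₀+m] : ∀ i → ℤ.0ℤ ℤ.< lin (a i) (b i) (+ (r₀ + m))
    0<L[r₀+m] i = subst (ℤ.0ℤ ℤ.<_) (sym (L-shift i m)) (ℤ.+<+ (≤-trans (1≤ℓ i) (m≤n+m (ℓ i) _)))
    0<H[r₀+m] : ∀ j → ℤ.0ℤ ℤ.< lin (c j) (d j) (+ (r₀ + m))
    0<H[r₀+m] j = subst (ℤ.0ℤ ℤ.<_) (sym (H-shift j m)) (ℤ.+<+ (≤-trans (1≤μ j) (m≤n+m (μ j) _)))
    σL<σH′ : ∀ j → maxFin (λ i → σ ∣ lin (a i) (b i) (+ (r₀ + m)) ∣) < σ ∣ lin (c j) (d j) (+ (r₀ + m)) ∣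
    σL<σH′ j = begin-strict
      maxFin (λ i → σ ∣ lin (a i) (b i) (+ (r₀ + m)) ∣)  ≤⟨ maxFin≤sumFin {k} _ ⟩
      sumFin (λ i → σ ∣ lin (a i) (b i) (+ (r₀ + m)) ∣)  ≤⟨ sumFin-mono-≤ (λ i → ≤-reflexive (cong (σ ∘ ∣_∣) (L-shift i m))) ⟩
      sumFin (λ i → σ (lin⁺ (a′ i) (ℓ i) m))             <⟨ σL<σH j ⟩
      σ (lin⁺ (c′ j) (μ j) m)                            ≡⟨ cong (σ ∘ ∣_∣) (H-shift j m) ⟨
      σ ∣ lin (c j) (d j) (+ (r₀ + m)) ∣                 ∎
      where open ≤-Reasoning

  good-suc? : ∀ n → Dec (Good a b c d (suc n))
  good-suc? n = good? a b c d (suc n)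

  good-in-progression? : ∀ t → Dec (Good a b c d (suc (r₁ + w + P * t)))
  good-in-progression? t = good-suc? (r₁ + w + P * t)

  good-in-progression : ∀ t → (∀ j → sumFin (λ i → σ (lin⁺ (a′ i) (ℓ i) (w + P * t))) < σ (lin⁺ (c′ j) (μ j) (w + P * t))) →
                        Good a b c d (suc (r₁ + w + P * t))
  good-in-progression t σL<σH = subst (λ n → Good a b c d (suc n)) (sym (+-assoc r₁ w (P * t))) (good-shifted (w + P * t) σL<σH)

  open InProgression 1≤k a′ ℓ c′ μ 1≤a′ 1≤c′ P w 1≤P w<P abundant coprime good-in-progression? good-in-progression using (s; window)

  count≡count< : ∀ x → count a b c d x ≡ count< good-suc? x
  count≡count< x = begin
    length (filter (good? a b c d) (map suc (upTo x)))       ≡⟨ length-filter (good? a b c d) (map suc (upTo x)) ⟩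
    sum (map (𝟙 ∘ good? a b c d) (map suc (upTo x)))         ≡⟨ cong sum (map-∘ (upTo x)) ⟨
    sum (map (𝟙 ∘ good-suc?) (upTo x))                       ≡⟨ sum-map-upTo _ x ⟩
    count< good-suc? x                                       ∎
    where open ≡-Reasoning

  C x₀ : ℕ
  C  = 16 * P
  x₀ = 4 * P * suc (suc s) + 2 * (r₁ + w)

  C≢0 : NonZero C
  C≢0 = m*n≢0 16 P {{_}} {{>-nonZero 1≤P}}

  x≤C*count : ∀ x → x₀ ≤ x → x ≤ C * count a b c d x
  x≤C*count x x₀≤x = subst (λ n → x ≤ C * n) (sym (count≡count< x))
    (density-from-windows good-suc? (r₁ + w) P (suc s) 1≤P window x x₀≤x)


open import Data.Integer.Divisibility using (_∣_)

theorem4 : (k : ℕ) → 1 ≤ k → (a b c d : Fin k → ℤ) →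
    (∀ i → ℤ.0ℤ ℤ.< a i) → (∀ j → ℤ.0ℤ ℤ.< c j) →
    (∀ i j → a i ℤ.* d j ≢ b i ℤ.* c j) →
    (∀ p → Prime p → ∃ λ (np : ℤ) → ∀ i → ¬ ((+ p) ∣ lin (a i) (b i) np)) →
    Σ ℕ λ C → NonZero C × Σ ℕ λ x₀ → ∀ x → x₀ ≤ x →
    x ≤ C * count a b c d x * (⌊log₂ x ⌋ ^ k)
theorem4 k 1≤k a b c d 0<a 0<c ad≢bc _ = C , C≢0 , x₀ + 2 , bound
  where
  open PositiveDensity 1≤k a b c d 0<a 0<c ad≢bc
  bound : ∀ x → x₀ + 2 ≤ x → x ≤ C * count a b c d x * (⌊log₂ x ⌋ ^ k)
  bound x x₀+2≤x = ≤-trans (x≤C*count x (≤-trans (m≤m+n x₀ 2) x₀+2≤x))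
                           (m≤m*n _ (⌊log₂ x ⌋ ^ k) {{m^n≢0 _ k {{log₂x≢0}}}})
    where
    log₂x≢0 : NonZero ⌊log₂ x ⌋
    log₂x≢0 = >-nonZero (⌊log₂⌋-mono-≤ {2} {x} (≤-trans (m≤n+m 2 x₀) x₀+2≤x))
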